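{- For every $n \geq 1$, $H_n$ is a Sylow $3$-subgroup of $E_n$, and $H_n$ is normal in $E_n$ if and only if $n=1$.
   Context: $T_n$ is the regular ternary rooted tree with $n$ levels: vertices at level $i$ are sequences $(\ell_1,\dots,\ell_i)$ with $\ell_j\in\{1,2,3\}$, and $(\ell_1,\dots,\ell_i)$ is joined to $(\ell_1,\dots,\ell_{i+1})$. $\mathrm{Aut}(T_n)$ is identified with $\mathrm{Aut}(T_{n-1})\wr\mathrm{Aut}(T_1)$: $((a_1,a_2,a_3),b)$ sends $(i,\ell_2,\dots,\ell_k)$ to $(b(i),a_i(\ell_2,\dots,\ell_k))$, and $\mathrm{Aut}(T_1)\cong\mathfrak S_3$ via the labels. $\mathrm{sgn}_2(\sigma)$ is the sign of the permutation induced by $\sigma$ on the 9 vertices of level $2$. Define $E_1=\mathrm{Aut}(T_1)$ and, for $n\ge2$, $E_n=\{\sigma=((a_1,a_2,a_3),b)\in\mathrm{Aut}(T_n): a_1,a_2,a_3\in E_{n-1},\ \mathrm{sgn}_2(\sigma)=1\}$. Let $C_3\subset\mathrm{Aut}(T_1)$ be the cyclic subgroup of order $3$; define $H_1=C_3$ and, for $n\ge2$, $H_n=H_{n-1}\wr C_3=\{((a_1,a_2,a_3),b): a_i\in H_{n-1}, b\in C_3\}\subseteq\mathrm{Aut}(T_n)$. -}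

module Defs where

open import Data.Nat using (ℕ; zero; suc; _+_; _*_; _^_; _<ᵇ_)
open import Data.Nat.Divisibility using (_∣_)
open import Data.Fin using (Fin; toℕ)
  renaming (zero to f0)
open import Data.Fin.Patterns using (0F; 1F; 2F)
open import Data.Bool using (Bool; true; false; _∧_; if_then_else_)
open import Data.List using (List; []; _∷_; length; filterᵇ; concatMap; map)
open import Data.Product using (_×_; _,_; Σ; ∃; proj₁; proj₂)
open import Relation.Binary.PropositionalEquality using (_≡_)
open import Relation.Nullary using (¬_)

-- The symmetric group S₃ = Aut(T₁), acting on the labels {1,2,3},
-- encoded as Fin 3 = {0F,1F,2F}.

data S3 : Set where
  e r r² t01 t02 t12 : S3

app : S3 → Fin 3 → Fin 3
app e   i  = i
app r   0F = 1F
app r   1F = 2F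
app r   2F = 0F
app r²  0F = 2F
app r²  1F = 0F
app r²  2F = 1F
app t01 0F = 1F
app t01 1F = 0F
app t01 2F = 2F
app t02 0F = 2F
app t02 1F = 1F
app t02 2F = 0F
app t12 0F = 0F
app t12 1F = 2F
app t12 2F = 1F

-- a permutation of {0,1,2} is determined by the images of 0 and 1
fromImages : Fin 3 → Fin 3 → S3
fromImages 0F 1F = e
fromImages 1F 2F = r
fromImages 2F 0F = r²
fromImages 1F 0F = t01
fromImages 2F 1F = t02
fromImages 0F 2F = t12
fromImages _  _  = e   -- impossible (non-injective) cases

_∘₃_ : S3 → S3 → S3
σ ∘₃ τ = fromImages (app σ (app τ 0F)) (app σ (app τ 1F))

inv₃ : S3 → S3
inv₃ e   = e
inv₃ r   = r²
inv₃ r²  = r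
inv₃ t01 = t01
inv₃ t02 = t02
inv₃ t12 = t12

allS3 : List S3
allS3 = e ∷ r ∷ r² ∷ t01 ∷ t02 ∷ t12 ∷ []

inC3 : S3 → Bool
inC3 e  = true
inC3 r  = true
inC3 r² = true
inC3 _  = false

-- Aut(T_n), with Aut(T_0) trivial and
-- Aut(T_{n+1}) = Aut(T_n) ≀ Aut(T_1): node a₁ a₂ a₃ b = ((a₁,a₂,a₃),b).
-- (Portrait representation: every automorphism corresponds to exactly
-- one such term.)

data Aut : ℕ → Set where
  leaf : Aut zero
  node : {n : ℕ} → Aut n → Aut n → Aut n → S3 → Aut (suc n)

sec : {n : ℕ} → Aut (suc n) → Fin 3 → Aut n
sec (node a₁ a₂ a₃ b) 0F = a₁
sec (node a₁ a₂ a₃ b) 1F = a₂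
sec (node a₁ a₂ a₃ b) 2F = a₃

top : {n : ℕ} → Aut (suc n) → S3
top (node _ _ _ b) = b

-- action on vertices (a vertex of level k ≤ n is a list of k labels):
-- ((a₁,a₂,a₃),b) sends (i ∷ w) to (b i ∷ a_i w)
act : {n : ℕ} → Aut n → List (Fin 3) → List (Fin 3)
act leaf w = w
act (node a₁ a₂ a₃ b) [] = []
act σ@(node a₁ a₂ a₃ b) (i ∷ w) = app b i ∷ act (sec σ i) w

-- composition (σ · τ) = σ ∘ τ (first τ, then σ):
-- ((σ·τ))_i = σ_{b_τ(i)} · τ_i, root b_σ ∘ b_τ
_·_ : {n : ℕ} → Aut n → Aut n → Aut n
leaf · leaf = leaf
σ@(node _ _ _ bσ) · τ@(node _ _ _ bτ) =
  node (sec σ (app bτ 0F) · sec τ 0F)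
       (sec σ (app bτ 1F) · sec τ 1F)
       (sec σ (app bτ 2F) · sec τ 2F)
       (bσ ∘₃ bτ)

one : {n : ℕ} → Aut n
one {zero}  = leaf
one {suc n} = node one one one e

inv : {n : ℕ} → Aut n → Aut n
inv leaf = leaf
inv σ@(node _ _ _ b) =
  node (inv (sec σ (app (inv₃ b) 0F)))
       (inv (sec σ (app (inv₃ b) 1F)))
       (inv (sec σ (app (inv₃ b) 2F)))
       (inv₃ b)

allAut : (n : ℕ) → List (Aut n)
allAut zero    = leaf ∷ []
allAut (suc n) =
  concatMap (λ a₁ → concatMap (λ a₂ → concatMap (λ a₃ →
    map (node a₁ a₂ a₃) allS3) (allAut n)) (allAut n)) (allAut n)

-- sgn₂ : sign of the permutation induced on the 9 vertices of level 2,
-- computed as the parity of the number of inversions.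

allFin3 : List (Fin 3)
allFin3 = 0F ∷ 1F ∷ 2F ∷ []

level2 : List (Fin 3 × Fin 3)
level2 = concatMap (λ i → map (λ j → (i , j)) allFin3) allFin3

code : Fin 3 × Fin 3 → ℕ
code (i , j) = 3 * toℕ i + toℕ j

onLevel2 : {n : ℕ} → Aut (suc (suc n)) → Fin 3 × Fin 3 → Fin 3 × Fin 3
onLevel2 σ (i , j) = app (top σ) i , app (top (sec σ i)) j

inversions : {n : ℕ} → Aut (suc (suc n)) → ℕ
inversions σ =
  length (filterᵇ (λ uv → (code (proj₁ uv) <ᵇ code (proj₂ uv)) ∧
                              (code (onLevel2 σ (proj₂ uv)) <ᵇ code (onLevel2 σ (proj₁ uv))))
                 (concatMap (λ u → map (λ v → (u , v)) level2) level2))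

isEven : ℕ → Bool
isEven zero          = true
isEven (suc zero)    = false
isEven (suc (suc k)) = isEven k

sgn₂-one : {n : ℕ} → Aut (suc (suc n)) → Bool
sgn₂-one σ = isEven (inversions σ)

isE : (n : ℕ) → Aut (suc n) → Bool
isE zero    σ = true
isE (suc n) σ = isE n (sec σ 0F) ∧ isE n (sec σ 1F) ∧ isE n (sec σ 2F) ∧ sgn₂-one σ

isH : (n : ℕ) → Aut (suc n) → Bool
isH zero    σ = inC3 (top σ)
isH (suc n) σ = isH n (sec σ 0F) ∧ isH n (sec σ 1F) ∧ isH n (sec σ 2F) ∧ inC3 (top σ)

_∈_ : {n : ℕ} → Aut n → (Aut n → Bool) → Set
σ ∈ P = P σ ≡ true

card : {n : ℕ} → (Aut n → Bool) → ℕ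
card {n} P = length (filterᵇ P (allAut n))

IsSubgroupOf : {n : ℕ} → (Aut n → Bool) → (Aut n → Bool) → Set
IsSubgroupOf {n} H G =
  (∀ (σ : Aut n) → σ ∈ H → σ ∈ G) ×
  (one ∈ H) ×
  (∀ (σ τ : Aut n) → σ ∈ H → τ ∈ H → (σ · τ) ∈ H) ×
  (∀ (σ : Aut n) → σ ∈ H → inv σ ∈ H)

IsSylowSubgroup : {n : ℕ} → ℕ → (Aut n → Bool) → (Aut n → Bool) → Set
IsSylowSubgroup p H G =
  IsSubgroupOf H G ×
  (∃ λ k → card H ≡ p ^ k) ×
  (∃ λ m → (card G ≡ card H * m) × ¬ (p ∣ m))

IsNormalIn : {n : ℕ} → (Aut n → Bool) → (Aut n → Bool) → Set
IsNormalIn {n} H G =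
  ∀ (g h : Aut n) → g ∈ G → h ∈ H → ((g · h) · inv g) ∈ H

module Submission where

-- Proposition 2.6: H_n = C₃ ≀ ⋯ ≀ C₃ is a Sylow 3-subgroup of E_n, normal
-- exactly when n = 1.  (Here m = n - 1; isH m and isE m are H_n and E_n.)
--
-- 1. Finite facts about S₃ (C₃ is closed under products, inverses and
--    conjugation) and the wreath sign formula
--       sgn₂((a₁,a₂,a₃),b) = sgn(b) · sgn(top a₁) · sgn(top a₂) · sgn(top a₃)
--    are verified by exhaustive computation over S₃.
-- 2. H_n ⊆ E_n is a subgroup, by induction on the level: sections and
--    root labels of elements of H_n lie in H_{n-1} and C₃, and C₃ ⊆ A₃.
-- 3. Counting: a predicate of the form "all three sections satisfy Y and the
--    root satisfies a condition met by exactly r of the six labels" has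
--    |Y|³·r elements.  For H this gives |H_{n+1}| = 3|H_n|³; for E, exactly
--    half of the root labels have the sign required by sgn₂ = 1, so also
--    |E_{n+1}| = 3|E_n|³.  Hence |H_n| = 3^k and [E_n : H_n] = 2^(3^(n-1)).
-- 4. For n ≥ 2, conjugating the root rotation by an element of E_n with a
--    transposition at the root leaves H_n; for n = 1, C₃ ◁ S₃.

open import Defs
open import Data.Nat using (ℕ; zero; suc; _+_; _*_; _^_; s≤s)
open import Data.Nat.Properties using (+-identityʳ; +-assoc; *-zeroʳ; *-distribˡ-+; *-distribʳ-+; ^-distribˡ-+-*)
open import Data.Nat.Divisibility using (_∣_; ∣⇒≤)
open import Data.Nat.Primality using (Prime; prime?; euclidsLemma)
open import Data.Nat.Tactic.RingSolver using (solve-∀)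
open import Data.Bool using (Bool; true; false; _∧_; _xor_; not)
open import Data.Bool.Properties using (_≟_)
open import Data.List using (List; []; _∷_; length; filterᵇ; concatMap; _++_)
open import Data.Fin.Patterns using (0F; 1F; 2F)
open import Data.Product using (_×_; _,_)
open import Data.Sum using ([_,_]′)
open import Data.Empty using (⊥-elim)
open import Relation.Nullary using (¬_; Dec)
open import Relation.Nullary.Decidable using (map′; from-yes; _×-dec_; _→-dec_)
open import Relation.Unary using (Decidable)
open import Function.Bundles using (_⇔_; mk⇔)
open import Relation.Binary.PropositionalEquality

-- A decidable property holds on all of S₃ iff it holds at its six elements;
-- with from-yes this turns a statement about S₃ into a computation.
∀S3? : {P : S3 → Set} → Decidable P → Dec (∀ s → P s)
∀S3? P? = map′
  (λ { (pe , pr , pr² , p01 , p02 , p12) →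
       λ { e → pe ; r → pr ; r² → pr² ; t01 → p01 ; t02 → p02 ; t12 → p12 } })
  (λ p → p e , p r , p r² , p t01 , p t02 , p t12)
  (P? e ×-dec P? r ×-dec P? r² ×-dec P? t01 ×-dec P? t02 ×-dec P? t12)

C3-∘ : ∀ a b → inC3 a ≡ true → inC3 b ≡ true → inC3 (a ∘₃ b) ≡ true
C3-∘ = from-yes (∀S3? λ a → ∀S3? λ b →
  inC3 a ≟ true →-dec inC3 b ≟ true →-dec inC3 (a ∘₃ b) ≟ true)

C3-inv : ∀ a → inC3 a ≡ true → inC3 (inv₃ a) ≡ true
C3-inv = from-yes (∀S3? λ a → inC3 a ≟ true →-dec inC3 (inv₃ a) ≟ true)

C3-normal : ∀ a b → inC3 b ≡ true → inC3 ((a ∘₃ b) ∘₃ inv₃ a) ≡ true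
C3-normal = from-yes (∀S3? λ a → ∀S3? λ b →
  inC3 b ≟ true →-dec inC3 ((a ∘₃ b) ∘₃ inv₃ a) ≟ true)

odd₃ : S3 → Bool
odd₃ t01 = true
odd₃ t02 = true
odd₃ t12 = true
odd₃ _   = false

C3-even : ∀ a → inC3 a ≡ true → odd₃ a ≡ false
C3-even e  _ = refl
C3-even r  _ = refl
C3-even r² _ = refl

level2Even : S3 → S3 → S3 → S3 → Bool
level2Even b b₁ b₂ b₃ = not (odd₃ b xor (odd₃ b₁ xor (odd₃ b₂ xor odd₃ b₃)))

-- The sign formula, checked on all 6⁴ level-2 portraits; the deeper parts
-- x, y, z of the tree do not act on level 2.
sgn₂-portrait : ∀ {n} {x₁ y₁ z₁ x₂ y₂ z₂ x₃ y₃ z₃ : Aut n} b b₁ b₂ b₃ →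
  sgn₂-one (node (node x₁ y₁ z₁ b₁) (node x₂ y₂ z₂ b₂) (node x₃ y₃ z₃ b₃) b)
    ≡ level2Even b b₁ b₂ b₃
sgn₂-portrait {x₁ = x₁} {y₁} {z₁} {x₂} {y₂} {z₂} {x₃} {y₃} {z₃} = from-yes
  (∀S3? λ b → ∀S3? λ b₁ → ∀S3? λ b₂ → ∀S3? λ b₃ →
    sgn₂-one (node (node x₁ y₁ z₁ b₁) (node x₂ y₂ z₂ b₂) (node x₃ y₃ z₃ b₃) b)
      ≟ level2Even b b₁ b₂ b₃)

sgn₂-tops : ∀ {n} b (a₁ a₂ a₃ : Aut (suc n)) →
  sgn₂-one (node a₁ a₂ a₃ b) ≡ level2Even b (top a₁) (top a₂) (top a₃)
sgn₂-tops b (node _ _ _ b₁) (node _ _ _ b₂) (node _ _ _ b₃) = sgn₂-portrait b b₁ b₂ b₃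

level2Even-C3 : ∀ b b₁ b₂ b₃ → inC3 b ≡ true → inC3 b₁ ≡ true → inC3 b₂ ≡ true →
  inC3 b₃ ≡ true → level2Even b b₁ b₂ b₃ ≡ true
level2Even-C3 b b₁ b₂ b₃ p p₁ p₂ p₃
  rewrite C3-even b p | C3-even b₁ p₁ | C3-even b₂ p₂ | C3-even b₃ p₃ = refl

∧-intro : ∀ {x y} → x ≡ true → y ≡ true → (x ∧ y) ≡ true
∧-intro refl refl = refl

∧-left : ∀ x {y} → (x ∧ y) ≡ true → x ≡ true
∧-left true _ = refl

∧-right : ∀ x {y} → (x ∧ y) ≡ true → y ≡ true
∧-right true p = p

H-intro : ∀ k {a₁ a₂ a₃} b → isH k a₁ ≡ true → isH k a₂ ≡ true → isH k a₃ ≡ true →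
  inC3 b ≡ true → isH (suc k) (node a₁ a₂ a₃ b) ≡ true
H-intro k b p₁ p₂ p₃ q = ∧-intro p₁ (∧-intro p₂ (∧-intro p₃ q))

E-intro : ∀ k {a₁ a₂ a₃} b → isE k a₁ ≡ true → isE k a₂ ≡ true → isE k a₃ ≡ true →
  sgn₂-one (node a₁ a₂ a₃ b) ≡ true → isE (suc k) (node a₁ a₂ a₃ b) ≡ true
E-intro k b p₁ p₂ p₃ q = ∧-intro p₁ (∧-intro p₂ (∧-intro p₃ q))

H-sec : ∀ k (σ : Aut (suc (suc k))) → isH (suc k) σ ≡ true → ∀ i → isH k (sec σ i) ≡ true
H-sec k (node a₁ a₂ a₃ _) p 0F = ∧-left (isH k a₁) p
H-sec k (node a₁ a₂ a₃ _) p 1F = ∧-left (isH k a₂) (∧-right (isH k a₁) p)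
H-sec k (node a₁ a₂ a₃ _) p 2F =
  ∧-left (isH k a₃) (∧-right (isH k a₂) (∧-right (isH k a₁) p))

H-top : ∀ k (σ : Aut (suc k)) → isH k σ ≡ true → inC3 (top σ) ≡ true
H-top zero σ p = p
H-top (suc k) σ@(node a₁ a₂ a₃ _) p =
  ∧-right (isH k a₃) (∧-right (isH k a₂) (∧-right (isH k a₁) p))

H-one : ∀ k → isH k one ≡ true
H-one zero    = refl
H-one (suc k) = H-intro k e (H-one k) (H-one k) (H-one k) refl

E-one : ∀ k → isE k one ≡ true
E-one zero    = refl
E-one (suc k) = E-intro k e (E-one k) (E-one k) (E-one k) refl

H-· : ∀ k (σ τ : Aut (suc k)) → isH k σ ≡ true → isH k τ ≡ true → isH k (σ · τ) ≡ true
H-· zero (node _ _ _ a) (node _ _ _ b) p q = C3-∘ a b p q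
H-· (suc k) σ@(node _ _ _ a) τ@(node _ _ _ b) p q = H-intro k (a ∘₃ b)
  (H-· k _ _ (H-sec k σ p (app b 0F)) (H-sec k τ q 0F))
  (H-· k _ _ (H-sec k σ p (app b 1F)) (H-sec k τ q 1F))
  (H-· k _ _ (H-sec k σ p (app b 2F)) (H-sec k τ q 2F))
  (C3-∘ a b (H-top (suc k) σ p) (H-top (suc k) τ q))

H-inv : ∀ k (σ : Aut (suc k)) → isH k σ ≡ true → isH k (inv σ) ≡ true
H-inv zero (node _ _ _ a) p = C3-inv a p
H-inv (suc k) σ@(node _ _ _ a) p = H-intro k (inv₃ a)
  (H-inv k _ (H-sec k σ p (app (inv₃ a) 0F)))
  (H-inv k _ (H-sec k σ p (app (inv₃ a) 1F)))
  (H-inv k _ (H-sec k σ p (app (inv₃ a) 2F)))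
  (C3-inv a (H-top (suc k) σ p))

-- H ⊆ E: all labels of an element of H are even, so sgn₂ = 1 at every level.
H⊆E : ∀ k (σ : Aut (suc k)) → isH k σ ≡ true → isE k σ ≡ true
H⊆E zero    σ p = refl
H⊆E (suc k) σ@(node a₁ a₂ a₃ b) p = E-intro k b
  (H⊆E k a₁ (H-sec k σ p 0F)) (H⊆E k a₂ (H-sec k σ p 1F)) (H⊆E k a₃ (H-sec k σ p 2F))
  (trans (sgn₂-tops b a₁ a₂ a₃)
    (level2Even-C3 b _ _ _ (H-top (suc k) σ p)
      (H-top k a₁ (H-sec k σ p 0F)) (H-top k a₂ (H-sec k σ p 1F))
      (H-top k a₃ (H-sec k σ p 2F))))

H-subgroup : ∀ k → IsSubgroupOf (isH k) (isE k)
H-subgroup k = H⊆E k , H-one k , H-· k , H-inv k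

∑ : {A : Set} → List A → (A → ℕ) → ℕ
∑ []       f = 0
∑ (x ∷ xs) f = f x + ∑ xs f

𝟙 : Bool → ℕ
𝟙 true  = 1
𝟙 false = 0

count-as-∑ : {A : Set} (P : A → Bool) (xs : List A) →
  length (filterᵇ P xs) ≡ ∑ xs (λ x → 𝟙 (P x))
count-as-∑ P [] = refl
count-as-∑ P (x ∷ xs) with P x
... | true  = cong suc (count-as-∑ P xs)
... | false = count-as-∑ P xs

∑-cong : {A : Set} (xs : List A) {f g : A → ℕ} → (∀ x → f x ≡ g x) → ∑ xs f ≡ ∑ xs g
∑-cong []       h = refl
∑-cong (x ∷ xs) h = cong₂ _+_ (h x) (∑-cong xs h)

∑-++ : {A : Set} (xs ys : List A) (f : A → ℕ) → ∑ (xs ++ ys) f ≡ ∑ xs f + ∑ ys f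
∑-++ []       ys f = refl
∑-++ (x ∷ xs) ys f = trans (cong (f x +_) (∑-++ xs ys f)) (sym (+-assoc (f x) _ _))

∑-concatMap : {A B : Set} (h : A → List B) (xs : List A) (f : B → ℕ) →
  ∑ (concatMap h xs) f ≡ ∑ xs (λ x → ∑ (h x) f)
∑-concatMap h []       f = refl
∑-concatMap h (x ∷ xs) f =
  trans (∑-++ (h x) _ f) (cong (∑ (h x) f +_) (∑-concatMap h xs f))

∑-*ʳ : {A : Set} (xs : List A) (f : A → ℕ) (k : ℕ) → ∑ xs (λ x → f x * k) ≡ ∑ xs f * k
∑-*ʳ []       f k = refl
∑-*ʳ (x ∷ xs) f k = trans (cong (f x * k +_) (∑-*ʳ xs f k)) (sym (*-distribʳ-+ k (f x) _))

∑-*ˡ : {A : Set} (xs : List A) (k : ℕ) (f : A → ℕ) → ∑ xs (λ x → k * f x) ≡ k * ∑ xs f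
∑-*ˡ []       k f = sym (*-zeroʳ k)
∑-*ˡ (x ∷ xs) k f = trans (cong (k * f x +_) (∑-*ˡ xs k f)) (sym (*-distribˡ-+ k (f x) _))

∑-cube : {A : Set} (xs : List A) (f : A → ℕ) (k : ℕ) →
  ∑ xs (λ x₁ → ∑ xs λ x₂ → ∑ xs λ x₃ → f x₁ * (f x₂ * (f x₃ * k)))
    ≡ ∑ xs f * (∑ xs f * (∑ xs f * k))
∑-cube xs f k = begin
  ∑ xs (λ x₁ → ∑ xs λ x₂ → ∑ xs λ x₃ → f x₁ * (f x₂ * (f x₃ * k)))
    ≡⟨ ∑-cong xs (λ x₁ → ∑-cong xs λ x₂ →
         trans (∑-*ˡ xs (f x₁) _) (cong (f x₁ *_) (∑-*ˡ xs (f x₂) _))) ⟩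
  ∑ xs (λ x₁ → ∑ xs λ x₂ → f x₁ * (f x₂ * S))
    ≡⟨ ∑-cong xs (λ x₁ → ∑-*ˡ xs (f x₁) _) ⟩
  ∑ xs (λ x₁ → f x₁ * ∑ xs (λ x₂ → f x₂ * S))
    ≡⟨ ∑-cong xs (λ x₁ → cong (f x₁ *_) (∑-*ʳ xs f S)) ⟩
  ∑ xs (λ x₁ → f x₁ * (∑ xs f * S))
    ≡⟨ ∑-*ʳ xs f _ ⟩
  ∑ xs f * (∑ xs f * S)
    ≡⟨ cong (λ z → ∑ xs f * (∑ xs f * z)) (∑-*ʳ xs f k) ⟩
  ∑ xs f * (∑ xs f * (∑ xs f * k)) ∎
  where
  open ≡-Reasoning
  S : ℕ
  S = ∑ xs (λ x → f x * k)

𝟙-∧ : ∀ p q → 𝟙 (p ∧ q) ≡ 𝟙 p * 𝟙 q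
𝟙-∧ true  q = sym (+-identityʳ (𝟙 q))
𝟙-∧ false q = refl

𝟙-∧₄ : ∀ p q s t → 𝟙 (p ∧ (q ∧ (s ∧ t))) ≡ 𝟙 p * (𝟙 q * (𝟙 s * 𝟙 t))
𝟙-∧₄ p q s t = trans (𝟙-∧ p _) (cong (𝟙 p *_) (trans (𝟙-∧ q _) (cong (𝟙 q *_) (𝟙-∧ s t))))

∑-allAut : ∀ {n} (f : Aut (suc n) → ℕ) →
  ∑ (allAut (suc n)) f ≡
  ∑ (allAut n) λ a₁ → ∑ (allAut n) λ a₂ → ∑ (allAut n) λ a₃ →
    ∑ allS3 λ b → f (node a₁ a₂ a₃ b)
∑-allAut {n} f =
  trans (∑-concatMap _ L f) (∑-cong L λ a₁ →
  trans (∑-concatMap _ L f) (∑-cong L λ a₂ →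
  trans (∑-concatMap _ L f) (∑-cong L λ a₃ → refl)))
  where
  L : List (Aut n)
  L = allAut n

-- The elements whose three sections satisfy Y and which satisfy a root
-- condition c; isH (suc k) and isE (suc k) are definitionally of this form.
wreathOf : ∀ {n} → (Aut n → Bool) → (Aut (suc n) → Bool) → Aut (suc n) → Bool
wreathOf Y c σ = Y (sec σ 0F) ∧ (Y (sec σ 1F) ∧ (Y (sec σ 2F) ∧ c σ))

card-wreath : ∀ {n} (Y : Aut n → Bool) (c : Aut (suc n) → Bool) (rr : ℕ) →
  (∀ a₁ a₂ a₃ → ∑ allS3 (λ b → 𝟙 (c (node a₁ a₂ a₃ b))) ≡ rr) →
  card (wreathOf Y c) ≡ card Y * (card Y * (card Y * rr))
card-wreath {n} Y c rr roots = begin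
  card (wreathOf Y c)
    ≡⟨ count-as-∑ (wreathOf Y c) (allAut (suc n)) ⟩
  ∑ (allAut (suc n)) (λ σ → 𝟙 (wreathOf Y c σ))
    ≡⟨ ∑-allAut (λ σ → 𝟙 (wreathOf Y c σ)) ⟩
  ∑ L (λ a₁ → ∑ L λ a₂ → ∑ L λ a₃ → ∑ allS3 λ b → 𝟙 (wreathOf Y c (node a₁ a₂ a₃ b)))
    ≡⟨ ∑-cong L (λ a₁ → ∑-cong L λ a₂ → ∑-cong L λ a₃ → fibre a₁ a₂ a₃) ⟩
  ∑ L (λ a₁ → ∑ L λ a₂ → ∑ L λ a₃ → y a₁ * (y a₂ * (y a₃ * rr)))
    ≡⟨ ∑-cube L y rr ⟩
  ∑ L y * (∑ L y * (∑ L y * rr))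
    ≡⟨ cong (λ z → z * (z * (z * rr))) (sym (count-as-∑ Y L)) ⟩
  card Y * (card Y * (card Y * rr)) ∎
  where
  open ≡-Reasoning
  L : List (Aut n)
  L = allAut n
  y : Aut n → ℕ
  y a = 𝟙 (Y a)
  fibre : ∀ a₁ a₂ a₃ →
    ∑ allS3 (λ b → 𝟙 (wreathOf Y c (node a₁ a₂ a₃ b))) ≡ y a₁ * (y a₂ * (y a₃ * rr))
  fibre a₁ a₂ a₃ = begin
    ∑ allS3 (λ b → 𝟙 (wreathOf Y c (node a₁ a₂ a₃ b)))
      ≡⟨ ∑-cong allS3 (λ b → 𝟙-∧₄ (Y a₁) (Y a₂) (Y a₃) (c (σ b))) ⟩
    ∑ allS3 (λ b → y a₁ * (y a₂ * (y a₃ * 𝟙 (c (σ b)))))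
      ≡⟨ ∑-*ˡ allS3 (y a₁) (λ b → y a₂ * (y a₃ * 𝟙 (c (σ b)))) ⟩
    y a₁ * ∑ allS3 (λ b → y a₂ * (y a₃ * 𝟙 (c (σ b))))
      ≡⟨ cong (y a₁ *_) (∑-*ˡ allS3 (y a₂) (λ b → y a₃ * 𝟙 (c (σ b)))) ⟩
    y a₁ * (y a₂ * ∑ allS3 (λ b → y a₃ * 𝟙 (c (σ b))))
      ≡⟨ cong (λ z → y a₁ * (y a₂ * z)) (∑-*ˡ allS3 (y a₃) (λ b → 𝟙 (c (σ b)))) ⟩
    y a₁ * (y a₂ * (y a₃ * ∑ allS3 (λ b → 𝟙 (c (σ b)))))
      ≡⟨ cong (λ z → y a₁ * (y a₂ * (y a₃ * z))) (roots a₁ a₂ a₃) ⟩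
    y a₁ * (y a₂ * (y a₃ * rr)) ∎
    where
    σ : S3 → Aut (suc n)
    σ = node a₁ a₂ a₃

wreathOrder : ℕ → ℕ
wreathOrder x = x * (x * (x * 3))

-- |H_{k+2}| = 3·|H_{k+1}|³: the root labels of H are the three elements of C₃.
card-H-suc : ∀ k → card (isH (suc k)) ≡ wreathOrder (card (isH k))
card-H-suc k = card-wreath (isH k) (λ σ → inC3 (top σ)) 3 (λ _ _ _ → refl)

half-of-S3 : ∀ x → ∑ allS3 (λ b → 𝟙 (not (odd₃ b xor x))) ≡ 3
half-of-S3 false = refl
half-of-S3 true  = refl

-- Whatever the sections, exactly half of the root labels give sgn₂ = 1.
card-E-suc : ∀ k → card (isE (suc k)) ≡ wreathOrder (card (isE k))
card-E-suc k = card-wreath (isE k) sgn₂-one 3 even-roots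
  where
  even-roots : ∀ a₁ a₂ a₃ → ∑ allS3 (λ b → 𝟙 (sgn₂-one (node a₁ a₂ a₃ b))) ≡ 3
  even-roots a₁ a₂ a₃ =
    trans (∑-cong allS3 λ b → cong 𝟙 (sgn₂-tops b a₁ a₂ a₃))
          (half-of-S3 (odd₃ (top a₁) xor (odd₃ (top a₂) xor odd₃ (top a₃))))

hExp : ℕ → ℕ
hExp zero    = 1
hExp (suc k) = hExp k + (hExp k + (hExp k + 1))

card-H : ∀ k → card (isH k) ≡ 3 ^ hExp k
card-H zero    = refl
card-H (suc k) = begin
  card (isH (suc k))                  ≡⟨ card-H-suc k ⟩
  wreathOrder (card (isH k))          ≡⟨ cong wreathOrder (card-H k) ⟩
  3 ^ a * (3 ^ a * (3 ^ a * 3 ^ 1))   ≡⟨ cong (λ z → 3 ^ a * (3 ^ a * z)) (sym (^-distribˡ-+-* 3 a 1)) ⟩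
  3 ^ a * (3 ^ a * 3 ^ (a + 1))       ≡⟨ cong (3 ^ a *_) (sym (^-distribˡ-+-* 3 a _)) ⟩
  3 ^ a * 3 ^ (a + (a + 1))           ≡⟨ sym (^-distribˡ-+-* 3 a _) ⟩
  3 ^ hExp (suc k)                    ∎
  where
  open ≡-Reasoning
  a : ℕ
  a = hExp k

-- The index [E_{k+1} : H_{k+1}] = 2^(3^k).
index : ℕ → ℕ
index zero    = 2
index (suc k) = index k * (index k * index k)

wreathOrder-* : ∀ h w → (h * w) * ((h * w) * ((h * w) * 3)) ≡ h * (h * (h * 3)) * (w * (w * w))
wreathOrder-* = solve-∀

card-E : ∀ k → card (isE k) ≡ card (isH k) * index k
card-E zero    = refl
card-E (suc k) = begin
  card (isE (suc k))                          ≡⟨ card-E-suc k ⟩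
  wreathOrder (card (isE k))                  ≡⟨ cong wreathOrder (card-E k) ⟩
  wreathOrder (card (isH k) * index k)        ≡⟨ wreathOrder-* (card (isH k)) (index k) ⟩
  wreathOrder (card (isH k)) * index (suc k)  ≡⟨ cong (_* index (suc k)) (sym (card-H-suc k)) ⟩
  card (isH (suc k)) * index (suc k)          ∎
  where open ≡-Reasoning

3-prime : Prime 3
3-prime = from-yes (prime? 3)

-- The index is a power of 2, hence prime to 3 (Euclid's lemma).
3∤index : ∀ k → ¬ (3 ∣ index k)
3∤index zero 3∣2 with ∣⇒≤ 3∣2
... | s≤s (s≤s ())
3∤index (suc k) 3∣cube = [ 3∤index k , 3∤square ]′ (euclidsLemma _ _ 3-prime 3∣cube)
  where
  3∤square : ¬ (3 ∣ index k * index k)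
  3∤square 3∣sq = [ 3∤index k , 3∤index k ]′ (euclidsLemma _ _ 3-prime 3∣sq)

H-sylow : ∀ k → IsSylowSubgroup 3 (isH k) (isE k)
H-sylow k = H-subgroup k , (hExp k , card-H k) , (index k , card-E k , 3∤index k)

H₁-normal : IsNormalIn (isH 0) (isE 0)
H₁-normal (node _ _ _ a) (node _ _ _ b) _ b∈C3 = C3-normal a b b∈C3

-- An element of E with the transposition (0 1) at the root; the transposition
-- is repeated at the first vertex of each level to keep sgn₂ even.
mutual
  swap : ∀ k → Aut (suc k)
  swap k = node (swapBelow k) one one t01

  swapBelow : ∀ k → Aut k
  swapBelow zero    = leaf
  swapBelow (suc k) = swap k

swap∈E : ∀ k → isE k (swap k) ≡ true
swap∈E zero    = refl
swap∈E (suc k) = E-intro k t01 (swap∈E k) (E-one k) (E-one k) refl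

rot : ∀ k → Aut (suc k)
rot k = node one one one r

rot∈H : ∀ k → isH k (rot k) ≡ true
rot∈H zero    = refl
rot∈H (suc k) = H-intro k r (H-one k) (H-one k) (H-one k) refl

-- Conjugating rot by swap moves the section swapBelow⁻¹ to the vertex 1F,
-- whose root label (0 1) is not in C₃.
conjugate-label : ∀ k →
  top (sec ((swap (suc k) · rot (suc k)) · inv (swap (suc k))) 1F) ≡ t01
conjugate-label k = refl

H-not-normal : ∀ k → ¬ IsNormalIn (isH (suc k)) (isE (suc k))
H-not-normal k normal = t01∉C3 (subst (λ t → inC3 t ≡ true) (conjugate-label k) label∈C3)
  where
  conj : Aut (suc (suc k))
  conj = (swap (suc k) · rot (suc k)) · inv (swap (suc k))
  label∈C3 : inC3 (top (sec conj 1F)) ≡ true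
  label∈C3 = H-top k (sec conj 1F)
    (H-sec k conj (normal (swap (suc k)) (rot (suc k)) (swap∈E (suc k)) (rot∈H (suc k))) 1F)
  t01∉C3 : ¬ (inC3 t01 ≡ true)
  t01∉C3 ()

normal-iff : ∀ m → IsNormalIn (isH m) (isE m) ⇔ suc m ≡ 1
normal-iff zero    = mk⇔ (λ _ → refl) (λ _ → H₁-normal)
normal-iff (suc k) = mk⇔ (λ normal → ⊥-elim (H-not-normal k normal)) (λ ())

proposition2p6 : (m : ℕ) →
    IsSylowSubgroup 3 (isH m) (isE m) × (IsNormalIn (isH m) (isE m) ⇔ suc m ≡ 1)
proposition2p6 m = H-sylow m , normal-iff m
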